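{- Let $\mathfrak M=\langle\mathfrak Q,V\rangle$ be a rational based model. Then: (i) for every irrational $x$, $\Sigma_x\subseteq\Lambda_x$; (ii) for every irrational $x$, $\Lambda_x$ is closed under conjunctions; (iii) for each nominal $i$, $\neg i$ is local at every irrational $x$; (iv) if $\mathbf B_h^+$ is sound with respect to $\mathfrak M$, then for every irrational $x$ and every $\phi\in\Lambda_x$, $\phi\to\bot$ is not a theorem of $\mathbf B_h^+$, so $\Lambda_x$ is $\mathbf B_h^+$-consistent.
   Context: $\mathfrak Q=\langle\mathbb Q,B_<\rangle$ with $B_<(a,b,c)$ iff $a<b<c$ or $c<b<a$. Formulas are those of $\mathcal H_\beta(@)$: $\varphi::=\top\mid p\mid i\mid\neg\varphi\mid\varphi\wedge\psi\mid\langle B\rangle(\varphi,\psi)\mid @_i\varphi$. A rational based model is $\langle\mathfrak Q,V\rangle$ with $V$ mapping propositional variables to subsets of $\mathbb Q$ and nominals to singletons; $a\Vdash\langle B\rangle(\varphi,\psi)$ iff there are $b,c$ with $b\Vdash\varphi$, $c\Vdash\psi$, $B_<(b,a,c)$; $a\Vdash i$ iff $V(i)=\{a\}$; $a\Vdash @_i\varphi$ iff the element of $V(i)$ satisfies $\varphi$. For irrational $x$: $\phi$ is local at $x$ if there are rationals $a<x<a'$ with every rational in $(a,a')$ satisfying $\phi$; $\Lambda_x$ is the set of formulas local at $x$; $\Sigma_x$ is the set of formulas $\langle B\rangle(\phi,\psi)$ such that there are rationals $a,a'$ with $a\Vdash\phi$, $a'\Vdash\psi$ and $x$ strictly between $a$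 and $a'$. $\mathbf B_h^+$ is sound w.r.t. $\mathfrak M$ if all its theorems are true at every point of $\mathfrak M$. $[B]$ is the dual of $\langle B\rangle$, $\mathsf C\varphi:=\langle B\rangle(\varphi,\varphi)$. $\mathbf B_h$ has axioms: propositional tautologies; $\neg\langle B\rangle(p,q)\leftrightarrow[B](\neg p,\neg q)$; $[B](p\to q,r)\to([B](p,r)\to[B](q,r))$; $[B](r,p\to q)\to([B](r,p)\to[B](r,q))$; $@_i(p\to q)\to(@_ip\to @_iq)$; $\neg @_ip\leftrightarrow @_i\neg p$; $@_ii$; $i\wedge p\to @_ip$; $\langle B\rangle(@_ip,q)\to @_ip$; $\langle B\rangle(q,@_ip)\to @_ip$; $@_i@_jp\to @_jp$; $@_ji\to @_ij$; $@_ij\wedge @_jp\to @_ip$; $@_i\langle B\rangle(j,k)\to\neg @_ij\wedge\neg @_ik\wedge\neg @_kj$; $\langle B\rangle(i,j)\to\langle B\rangle(j,i)$; $@_j\langle B\rangle(i,k)\to\neg @_k\langle B\rangle(i,j)$; $@_j\langle B\rangle(i,k)\wedge @_k\langle B\rangle(j,l)\to @_j\langle B\rangle(i,l)\wedge @_k\langle B\rangle(i,l)$; $@_j\langle B\rangle(i,k)\wedge @_l\langle B\rangle(i,j)\to @_l\langle B\rangle(i,k)\wedge @_j\langle B\rangle(l,k)$; $\neg @_ij\wedge\neg @_ik\wedge\neg @_kj\to @_j\langle B\rangle(i,k)\vee @_k\langle B\rangle(i,j)\vee @_i\langle B\rangle(j,k)$; $\langle B\rangle(\top,\top)$; $\langle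 B\rangle(i,j)\to\mathsf C\mathsf C(i\vee j)$. Rules: modus ponens; from $\vdash\varphi$ infer $\vdash[B](\varphi,\psi)$ and $\vdash[B](\psi,\varphi)$; from $\vdash\varphi$ infer $\vdash @_i\varphi$; uniform substitution; Name: from $\vdash i\to\theta$ infer $\vdash\theta$ if $i\notin\theta$; Paste: from $\vdash @_i\langle B\rangle(j,k)\wedge @_j\varphi\wedge @_k\psi\to\theta$ infer $\vdash @_i\langle B\rangle(\varphi,\psi)\to\theta$ if $i,j,k$ pairwise distinct and $j,k$ not in $\varphi,\psi,\theta$. $\mathbf B_h^+$ is $\mathbf B_h$ plus $\mathsf E\mathsf Cp\wedge\mathsf E\mathsf Cq\wedge\mathsf A(\mathsf Cp\to p)\wedge\mathsf A(\mathsf Cq\to q)\wedge\neg\mathsf E(p\wedge q)\to\mathsf E(\langle B\rangle(p,q)\wedge\neg\mathsf Cp\wedge\neg\mathsf Cq)$, with $\mathsf E\varphi:=\langle B\rangle(\varphi,\top)\vee\varphi$, $\mathsf A\varphi:=\neg\mathsf E\neg\varphi$. -}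

module Defs where

open import Data.Nat using (ℕ; _≡ᵇ_)
open import Data.Bool using (Bool; true; false; not; _∧_; _∨_)
open import Data.Rational using (ℚ; _<_)
open import Data.Product using (Σ; ∃; ∃-syntax; _×_; _,_)
open import Data.Sum using (_⊎_)
open import Data.Empty using (⊥)
open import Data.Unit using () renaming (⊤ to Unit)
open import Data.List using (List; []; _∷_)
open import Data.List.Relation.Unary.All using (All)
open import Relation.Nullary using (¬_)
open import Relation.Binary.PropositionalEquality using (_≡_; _≢_)

infixr 6 _∧ᶠ_
infixr 5 _∨ᶠ_
infixr 4 _⇒_ _⇔_

data Formula : Set where
  ⊤ᶠ   : Formula
  pv   : ℕ → Formula
  nm   : ℕ → Formula
  ¬ᶠ_  : Formula → Formula
  _∧ᶠ_ : Formula → Formula → Formula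
  ⟨B⟩  : Formula → Formula → Formula
  at⟨_⟩ : ℕ → Formula → Formula

⊥ᶠ : Formula
⊥ᶠ = ¬ᶠ ⊤ᶠ

_∨ᶠ_ : Formula → Formula → Formula
φ ∨ᶠ ψ = ¬ᶠ (¬ᶠ φ ∧ᶠ ¬ᶠ ψ)

_⇒_ : Formula → Formula → Formula
φ ⇒ ψ = ¬ᶠ (φ ∧ᶠ ¬ᶠ ψ)

_⇔_ : Formula → Formula → Formula
φ ⇔ ψ = (φ ⇒ ψ) ∧ᶠ (ψ ⇒ φ)

[B] : Formula → Formula → Formula
[B] φ ψ = ¬ᶠ ⟨B⟩ (¬ᶠ φ) (¬ᶠ ψ)

C : Formula → Formula
C φ = ⟨B⟩ φ φ

E : Formula → Formula
E φ = ⟨B⟩ φ ⊤ᶠ ∨ᶠ φ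

A : Formula → Formula
A φ = ¬ᶠ E (¬ᶠ φ)

B< : ℚ → ℚ → ℚ → Set
B< a b c = (a < b × b < c) ⊎ (c < b × b < a)

record Model : Set₁ where
  field
    Vp : ℕ → ℚ → Set
    Vn : ℕ → ℚ            -- V(i_n) = { Vn n }
open Model public

_,_⊩_ : Model → ℚ → Formula → Set
M , a ⊩ ⊤ᶠ = Unit
M , a ⊩ pv n = Vp M n a
M , a ⊩ nm n = Vn M n ≡ a
M , a ⊩ (¬ᶠ φ) = ¬ (M , a ⊩ φ)
M , a ⊩ (φ ∧ᶠ ψ) = (M , a ⊩ φ) × (M , a ⊩ ψ)
M , a ⊩ ⟨B⟩ φ ψ = ∃[ b ] ∃[ c ] ((M , b ⊩ φ) × (M , c ⊩ ψ) × B< b a c)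
M , a ⊩ at⟨ i ⟩ φ = M , Vn M i ⊩ φ

-- Irrational numbers, represented as Dedekind cuts of ℚ with no
-- rational boundary point: Lo q means q < x, Up q means x < q.

record Irrational : Set₁ where
  field
    Lo Up      : ℚ → Set
    lo-inh     : ∃[ q ] Lo q
    up-inh     : ∃[ q ] Up q
    lo-down    : ∀ {q r} → r < q → Lo q → Lo r
    up-up      : ∀ {q r} → q < r → Up q → Up r
    lo-open    : ∀ {q} → Lo q → ∃[ r ] (q < r × Lo r)
    up-open    : ∀ {q} → Up q → ∃[ r ] (r < q × Up r)
    disjoint   : ∀ q → Lo q → Up q → ⊥
    -- x is irrational: every rational lies strictly below or above x
    dichotomy  : ∀ q → Lo q ⊎ Up q
open Irrational public

Local : Model → Irrational → Formula → Set
Local M x φ = ∃[ a ] ∃[ a' ] (Lo x a × Up x a' × (∀ b → a < b → b < a' → M , b ⊩ φ))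

Λ : Model → Irrational → Formula → Set
Λ = Local

Σₓ : Model → Irrational → Formula → Set
Σₓ M x χ = ∃[ φ ] ∃[ ψ ] (χ ≡ ⟨B⟩ φ ψ × ∃[ a ] ∃[ a' ]
   ((M , a ⊩ φ) × (M , a' ⊩ ψ) × ((Lo x a × Up x a') ⊎ (Lo x a' × Up x a))))

-- propositional tautologies: true under every Boolean valuation of the
-- non-Boolean subformulas (variables, nominals, ⟨B⟩-, @-formulas)
evalB : (Formula → Bool) → Formula → Bool
evalB v ⊤ᶠ = true
evalB v (¬ᶠ φ) = not (evalB v φ)
evalB v (φ ∧ᶠ ψ) = evalB v φ ∧ evalB v ψ
evalB v φ = v φ

Tautology : Formula → Set
Tautology φ = ∀ (v : Formula → Bool) → evalB v φ ≡ true

occurs : ℕ → Formula → Bool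
occurs i ⊤ᶠ = false
occurs i (pv n) = false
occurs i (nm n) = i ≡ᵇ n
occurs i (¬ᶠ φ) = occurs i φ
occurs i (φ ∧ᶠ ψ) = occurs i φ ∨ occurs i ψ
occurs i (⟨B⟩ φ ψ) = occurs i φ ∨ occurs i ψ
occurs i (at⟨ n ⟩ φ) = (i ≡ᵇ n) ∨ occurs i φ

_∉_ : ℕ → Formula → Set
i ∉ φ = occurs i φ ≡ false

sub : (ℕ → Formula) → (ℕ → ℕ) → Formula → Formula
sub σ τ ⊤ᶠ = ⊤ᶠ
sub σ τ (pv n) = σ n
sub σ τ (nm n) = nm (τ n)
sub σ τ (¬ᶠ φ) = ¬ᶠ sub σ τ φ
sub σ τ (φ ∧ᶠ ψ) = sub σ τ φ ∧ᶠ sub σ τ ψ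
sub σ τ (⟨B⟩ φ ψ) = ⟨B⟩ (sub σ τ φ) (sub σ τ ψ)
sub σ τ (at⟨ n ⟩ φ) = at⟨ τ n ⟩ (sub σ τ φ)

p q r : Formula
p = pv 0
q = pv 1
r = pv 2

i j k l : ℕ
i = 0
j = 1
k = 2
l = 3

data Axiom : Formula → Set where
  ax-dual   : Axiom (¬ᶠ ⟨B⟩ p q ⇔ [B] (¬ᶠ p) (¬ᶠ q))
  ax-KL     : Axiom ([B] (p ⇒ q) r ⇒ ([B] p r ⇒ [B] q r))
  ax-KR     : Axiom ([B] r (p ⇒ q) ⇒ ([B] r p ⇒ [B] r q))
  ax-Kat     : Axiom (at⟨ i ⟩ (p ⇒ q) ⇒ (at⟨ i ⟩ p ⇒ at⟨ i ⟩ q))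
  ax-selfdual : Axiom (¬ᶠ at⟨ i ⟩ p ⇔ at⟨ i ⟩ (¬ᶠ p))
  ax-ref    : Axiom (at⟨ i ⟩ (nm i))
  ax-intro  : Axiom ((nm i ∧ᶠ p) ⇒ at⟨ i ⟩ p)
  ax-backL  : Axiom (⟨B⟩ (at⟨ i ⟩ p) q ⇒ at⟨ i ⟩ p)
  ax-backR  : Axiom (⟨B⟩ q (at⟨ i ⟩ p) ⇒ at⟨ i ⟩ p)
  ax-agree  : Axiom (at⟨ i ⟩ (at⟨ j ⟩ p) ⇒ at⟨ j ⟩ p)
  ax-sym    : Axiom (at⟨ j ⟩ (nm i) ⇒ at⟨ i ⟩ (nm j))
  ax-nom    : Axiom ((at⟨ i ⟩ (nm j) ∧ᶠ at⟨ j ⟩ p) ⇒ at⟨ i ⟩ p)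
  ax-distinct : Axiom (at⟨ i ⟩ (⟨B⟩ (nm j) (nm k)) ⇒
                  (¬ᶠ at⟨ i ⟩ (nm j) ∧ᶠ ¬ᶠ at⟨ i ⟩ (nm k) ∧ᶠ ¬ᶠ at⟨ k ⟩ (nm j)))
  ax-Bsym   : Axiom (⟨B⟩ (nm i) (nm j) ⇒ ⟨B⟩ (nm j) (nm i))
  ax-Basym  : Axiom (at⟨ j ⟩ (⟨B⟩ (nm i) (nm k)) ⇒ ¬ᶠ at⟨ k ⟩ (⟨B⟩ (nm i) (nm j)))
  ax-Btr1   : Axiom ((at⟨ j ⟩ (⟨B⟩ (nm i) (nm k)) ∧ᶠ at⟨ k ⟩ (⟨B⟩ (nm j) (nm l))) ⇒
                  (at⟨ j ⟩ (⟨B⟩ (nm i) (nm l)) ∧ᶠ at⟨ k ⟩ (⟨B⟩ (nm i) (nm l))))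
  ax-Btr2   : Axiom ((at⟨ j ⟩ (⟨B⟩ (nm i) (nm k)) ∧ᶠ at⟨ l ⟩ (⟨B⟩ (nm i) (nm j))) ⇒
                  (at⟨ l ⟩ (⟨B⟩ (nm i) (nm k)) ∧ᶠ at⟨ j ⟩ (⟨B⟩ (nm l) (nm k))))
  ax-conn   : Axiom ((¬ᶠ at⟨ i ⟩ (nm j) ∧ᶠ ¬ᶠ at⟨ i ⟩ (nm k) ∧ᶠ ¬ᶠ at⟨ k ⟩ (nm j)) ⇒
                  (at⟨ j ⟩ (⟨B⟩ (nm i) (nm k)) ∨ᶠ at⟨ k ⟩ (⟨B⟩ (nm i) (nm j))
                     ∨ᶠ at⟨ i ⟩ (⟨B⟩ (nm j) (nm k))))
  ax-ser    : Axiom (⟨B⟩ ⊤ᶠ ⊤ᶠ)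
  ax-dense  : Axiom (⟨B⟩ (nm i) (nm j) ⇒ C (C (nm i ∨ᶠ nm j)))
  -- the extra axiom of B_h^+
  ax-plus   : Axiom ((E (C p) ∧ᶠ E (C q) ∧ᶠ A (C p ⇒ p) ∧ᶠ A (C q ⇒ q) ∧ᶠ ¬ᶠ E (p ∧ᶠ q)) ⇒
                  E (⟨B⟩ p q ∧ᶠ ¬ᶠ C p ∧ᶠ ¬ᶠ C q))

data Thm : Formula → Set where
  taut  : ∀ {φ} → Tautology φ → Thm φ
  axiom : ∀ {φ} → Axiom φ → Thm φ
  mp    : ∀ {φ ψ} → Thm (φ ⇒ ψ) → Thm φ → Thm ψ
  necL  : ∀ {φ} ψ → Thm φ → Thm ([B] φ ψ)
  necR  : ∀ {φ} ψ → Thm φ → Thm ([B] ψ φ)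
  necAt  : ∀ {φ} n → Thm φ → Thm (at⟨ n ⟩ φ)
  usub  : ∀ {φ} (σ : ℕ → Formula) (τ : ℕ → ℕ) → Thm φ → Thm (sub σ τ φ)
  name  : ∀ {θ} n → n ∉ θ → Thm (nm n ⇒ θ) → Thm θ
  paste : ∀ {φ ψ θ} a b c → a ≢ b → a ≢ c → b ≢ c →
          b ∉ φ → b ∉ ψ → b ∉ θ → c ∉ φ → c ∉ ψ → c ∉ θ →
          Thm ((at⟨ a ⟩ (⟨B⟩ (nm b) (nm c)) ∧ᶠ at⟨ b ⟩ φ ∧ᶠ at⟨ c ⟩ ψ) ⇒ θ) →
          Thm (at⟨ a ⟩ (⟨B⟩ φ ψ) ⇒ θ)

Sound : Model → Set
Sound M = ∀ φ → Thm φ → ∀ a → M , a ⊩ φ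

⋀ : List Formula → Formula
⋀ [] = ⊤ᶠ
⋀ (φ ∷ φs) = φ ∧ᶠ ⋀ φs

Consistent : (Formula → Set) → Set
Consistent Γ = ∀ (φs : List Formula) → All Γ φs → ¬ Thm (⋀ φs ⇒ ⊥ᶠ)

{-# OPTIONS --safe #-}
module Submission where

-- Every neighbourhood of an irrational cut contains rationals, so a local
-- formula is satisfied somewhere; soundness then forbids refuting it, and
-- since locality is closed under ⊤ and ∧ this extends to finite conjunctions.

open import Defs
open import Data.Empty using (⊥-elim)
open import Data.List using ([]; _∷_)
open import Data.List.Relation.Unary.All using (All; []; _∷_)
open import Data.Product using (_×_; _,_; ∃-syntax)
open import Data.Rational using (_<_; _⊔_; _⊓_)
open import Data.Rational.Properties
  using (<-cmp; <-trans; ≤-<-trans; <-≤-trans; <⇒≢; ⊔-sel; ⊓-sel; p≤p⊔q; p≤q⊔p; p⊓q≤p; p⊓q≤q)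
open import Data.Sum using (inj₁; inj₂)
open import Data.Unit using (tt)
open import Relation.Binary.Definitions using (tri<; tri≈; tri>)
open import Relation.Binary.PropositionalEquality using (_≢_; refl; sym; subst; ≢-sym)
open import Relation.Nullary using (¬_)

module _ (x : Irrational) where

  lo<up : ∀ {a b} → Lo x a → Up x b → a < b
  lo<up {a} {b} la ub with <-cmp a b
  ... | tri< a<b _ _ = a<b
  ... | tri≈ _ refl _ = ⊥-elim (disjoint x a la ub)
  ... | tri> _ _ b<a = ⊥-elim (disjoint x b (lo-down x b<a la) ub)

  lo-⊔ : ∀ {a b} → Lo x a → Lo x b → Lo x (a ⊔ b)
  lo-⊔ {a} {b} la lb with ⊔-sel a b
  ... | inj₁ eq = subst (Lo x) (sym eq) la
  ... | inj₂ eq = subst (Lo x) (sym eq) lb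

  up-⊓ : ∀ {a b} → Up x a → Up x b → Up x (a ⊓ b)
  up-⊓ {a} {b} ua ub with ⊓-sel a b
  ... | inj₁ eq = subst (Up x) (sym eq) ua
  ... | inj₂ eq = subst (Up x) (sym eq) ub

  neighbourhood-avoiding : ∀ c →
    ∃[ a ] ∃[ a' ] (Lo x a × Up x a' × (∀ b → a < b → b < a' → c ≢ b))
  neighbourhood-avoiding c with dichotomy x c
  ... | inj₁ lc with lo-open x lc | up-inh x
  ...   | a , c<a , la | a' , ua' =
    a , a' , la , ua' , λ b a<b _ → <⇒≢ (<-trans c<a a<b)
  neighbourhood-avoiding c | inj₂ uc with up-open x uc | lo-inh x
  ...   | a' , a'<c , ua' | a , la =
    a , a' , la , ua' , λ b _ b<a' → ≢-sym (<⇒≢ (<-trans b<a' a'<c))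

module _ (M : Model) (x : Irrational) where

  Σₓ⊆Λ : ∀ {φ} → Σₓ M x φ → Λ M x φ
  Σₓ⊆Λ (φ , ψ , refl , a , a' , a⊩φ , a'⊩ψ , inj₁ (la , ua')) =
    a , a' , la , ua' , λ b a<b b<a' → a , a' , a⊩φ , a'⊩ψ , inj₁ (a<b , b<a')
  Σₓ⊆Λ (φ , ψ , refl , a , a' , a⊩φ , a'⊩ψ , inj₂ (la' , ua)) =
    a' , a , la' , ua , λ b a'<b b<a → a , a' , a⊩φ , a'⊩ψ , inj₂ (a'<b , b<a)

  local-⊤ : Local M x ⊤ᶠ
  local-⊤ with lo-inh x | up-inh x
  ... | a , la | a' , ua' = a , a' , la , ua' , λ _ _ _ → tt

  local-∧ : ∀ φ ψ → Local M x φ → Local M x ψ → Local M x (φ ∧ᶠ ψ)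
  local-∧ φ ψ (a₁ , a₁' , la₁ , ua₁' , in₁) (a₂ , a₂' , la₂ , ua₂' , in₂) =
    a₁ ⊔ a₂ , a₁' ⊓ a₂' , lo-⊔ x la₁ la₂ , up-⊓ x ua₁' ua₂' , λ b lo<b b<up →
      in₁ b (≤-<-trans (p≤p⊔q a₁ a₂) lo<b) (<-≤-trans b<up (p⊓q≤p a₁' a₂')) ,
      in₂ b (≤-<-trans (p≤q⊔p a₁ a₂) lo<b) (<-≤-trans b<up (p⊓q≤q a₁' a₂'))

  local-⋀ : ∀ φs → All (Local M x) φs → Local M x (⋀ φs)
  local-⋀ [] [] = local-⊤
  local-⋀ (φ ∷ φs) (lφ ∷ lφs) = local-∧ φ (⋀ φs) lφ (local-⋀ φs lφs)

  local-¬nm : ∀ n → Local M x (¬ᶠ nm n)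
  local-¬nm n = neighbourhood-avoiding x (Vn M n)

  local⇒satisfiable : ∀ φ → Local M x φ → ∃[ b ] (M , b ⊩ φ)
  local⇒satisfiable φ (a , a' , la , ua' , inside) with lo-open x la
  ... | b , a<b , lb = b , inside b a<b (lo<up x lb ua')

  local⇒unrefutable : Sound M → ∀ φ → Local M x φ → ¬ Thm (φ ⇒ ⊥ᶠ)
  local⇒unrefutable sound φ lφ ⊢¬φ with local⇒satisfiable φ lφ
  ... | b , b⊩φ = sound _ ⊢¬φ b (b⊩φ , λ ¬⊤ → ¬⊤ tt)

lemma7p16 : (M : Model) →
    ((x : Irrational) → ∀ φ → Σₓ M x φ → Λ M x φ)
    × ((x : Irrational) → ∀ φ ψ → Λ M x φ → Λ M x ψ → Λ M x (φ ∧ᶠ ψ))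
    × (∀ n → (x : Irrational) → Local M x (¬ᶠ nm n))
    × (Sound M → (x : Irrational) →
         (∀ φ → Λ M x φ → ¬ Thm (φ ⇒ ⊥ᶠ)) × Consistent (Λ M x))
lemma7p16 M =
    (λ x _ → Σₓ⊆Λ M x)
  , (λ x → local-∧ M x)
  , (λ n x → local-¬nm M x n)
  , λ sound x →
      local⇒unrefutable M x sound
    , λ φs lφs → local⇒unrefutable M x sound (⋀ φs) (local-⋀ M x φs lφs)
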